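{- Let $q\ge2$ and $n\ge1$ be integers. Under each of the scenarios $(*\bullet)$ and $(\bullet\bullet)$, the family $\mathcal{G}_q=\{x\mapsto[\![x\ge t]\!]\}_{t\in[q\rangle}$ is $n$-cell implementable if and only if $q\le 2n+1$.
   Context: $[b\rangle=\{0,1,\ldots,b-1\}$. Let $\mathbb{B}=\{0,1\}$, $\mathbb{B}_\circ=\mathbb{B}$, $\mathbb{B}_*=\mathbb{B}\cup\{*\}$, $\mathbb{B}_\bullet=\mathbb{B}\cup\{*,\bullet\}$. Define $\mathrm{T}:\mathbb{B}_\bullet^2\to\mathbb{B}$ by $\mathrm{T}(u,\vartheta)=1$ if and only if $u=*$, or $\vartheta=*$, or $u=\vartheta\in\mathbb{B}$. $[\![\cdot]\!]$ is the Iverson bracket. $\mathcal{F}_q$ is the set of all functions $[q\rangle\to\mathbb{B}$. For $\alpha,\beta\in\{\circ,*,\bullet\}$, a subset $\Phi\subseteq\mathcal{F}_q$ is $n$-cell implementable under scenario $(\alpha\beta)$ if there exist mappings $\mathbf{u}=(u_j)_{j\in[n\rangle}:[q\rangle\to\mathbb{B}_\alpha^n$ and $\boldsymbol{\vartheta}=(\vartheta_j)_{j\in[n\rangle}:\Phi\to\mathbb{B}_\beta^n$ such that $f(x)=\bigwedge_{j\in[n\rangle}\mathrm{T}(u_j(x),\vartheta_j(f))$ for all $f\in\Phi$ and $x\in[q\rangle$. -}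

module Defs where

open import Data.Nat using (ℕ; zero; suc)
open import Data.Fin using (Fin; zero; suc; _≤?_)
open import Data.Bool using (Bool; true; false; _∧_)
open import Data.Unit using (⊤)
open import Data.Empty using (⊥)
open import Data.Product using (Σ; _×_)
open import Relation.Binary.PropositionalEquality using (_≡_)
open import Relation.Nullary.Decidable using (⌊_⌋)

data Sym : Set where
  b0 b1 star bullet : Sym

data Scen : Set where
  sc∘ sc* sc• : Scen

InB : Scen → Sym → Set
InB sc∘ b0 = ⊤
InB sc∘ b1 = ⊤
InB sc∘ star = ⊥
InB sc∘ bullet = ⊥
InB sc* bullet = ⊥
InB sc* _ = ⊤
InB sc• _ = ⊤

T : Sym → Sym → Bool
T star _ = true
T _ star = true
T b0 b0 = true
T b1 b1 = true
T _ _ = false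

⋀ : (n : ℕ) → (Fin n → Bool) → Bool
⋀ zero    g = true
⋀ (suc n) g = g zero ∧ ⋀ n (λ j → g (suc j))

Implementable : (α β : Scen) (q n : ℕ) {I : Set} → (I → Fin q → Bool) → Set
Implementable α β q n {I} Φ =
  Σ (Fin q → Fin n → Sym) λ u →
  Σ (I → Fin n → Sym) λ ϑ →
    ((x : Fin q) (j : Fin n) → InB α (u x j)) ×
    ((i : I) (j : Fin n) → InB β (ϑ i j)) ×
    ((i : I) (x : Fin q) → Φ i x ≡ ⋀ n (λ j → T (u x j) (ϑ i j)))

G : (q : ℕ) → Fin q → Fin q → Bool
G q t x = ⌊ t ≤? x ⌋

-- Input k lies below threshold k + 1, so some cell rejects that pair.  No cell
-- rejects the pairs of three indices a < b < d: its symbols for threshold a + 1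
-- and input d are not * (each takes part in a rejection), yet with input b and
-- threshold b + 1 they give three passes of T and one failure, which needs a *
-- (T-rectangle).  So the q − 1 positive thresholds need at least (q − 1)/2 cells,
-- and a cell serving two consecutive thresholds realises this bound.
module Submission where

open import Defs
open import Data.Nat using (ℕ; _≤_; _+_; _*_)
open import Data.Sum using (_⊎_)
open import Function.Bundles using (_⇔_)
open import Relation.Binary.PropositionalEquality using (_≡_)

open import Data.Nat as ℕ using (zero; suc; z≤n; s≤s; z<s; s<s; ⌊_/2⌋)
import Data.Nat.Properties as ℕ
open import Data.Fin as Fin using (Fin; toℕ; inject₁; fromℕ<; combine)
import Data.Fin.Properties as Fin
open import Data.Bool using (Bool; true; false)
open import Data.Unit using (tt)
open import Data.Empty using (⊥; ⊥-elim)
open import Data.Product using (∃; _×_; _,_; proj₁; proj₂)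
open import Data.Sum using (inj₁; inj₂)
open import Function.Bundles using (mk⇔)
open import Relation.Binary.PropositionalEquality
  using (_≢_; refl; sym; trans; cong; subst)
open import Relation.Nullary using (Dec; yes; no; contradiction)
open import Relation.Nullary.Decidable using (isYes≗does; dec-true; dec-false; _×-dec_)

private
  variable
    a b a₁ a₂ b₁ b₂ : Sym

T-starʳ : ∀ a → T a star ≡ true
T-starʳ b0     = refl
T-starʳ b1     = refl
T-starʳ star   = refl
T-starʳ bullet = refl

T≡false⇒≢starˡ : T a b ≡ false → a ≢ star
T≡false⇒≢starˡ () refl

T≡false⇒≢starʳ : T a b ≡ false → b ≢ star
T≡false⇒≢starʳ {a} T≡false refl = contradiction (trans (sym (T-starʳ a)) T≡false) λ ()

T≡true⇒≡ : T a b ≡ true → a ≢ star → b ≢ star → a ≡ b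
T≡true⇒≡ {star}           _ a≢star _      = contradiction refl a≢star
T≡true⇒≡ {b0}   {star}    _ _      b≢star = contradiction refl b≢star
T≡true⇒≡ {b1}   {star}    _ _      b≢star = contradiction refl b≢star
T≡true⇒≡ {bullet} {star}  _ _      b≢star = contradiction refl b≢star
T≡true⇒≡ {b0}   {b0}      _ _      _      = refl
T≡true⇒≡ {b1}   {b1}      _ _      _      = refl

-- Unless b₁ or a₁ is the wildcard, the two passes through b₁ force a₂ = b₁ = a₁,
-- and then a₂ would pass b₂ like a₁ does.
T-rectangle : T a₂ b₂ ≡ false → T a₂ b₁ ≡ true → T a₁ b₁ ≡ true → T a₁ b₂ ≡ true →
              b₁ ≢ star → a₁ ≢ star → ⊥
T-rectangle {a₂} {b₂} {a₁ = a₁} T₂₂ T₂₁ T₁₁ T₁₂ b₁≢star a₁≢star =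
  contradiction (trans (sym T₂₂) (subst (λ a → T a b₂ ≡ true) (sym a₂≡a₁) T₁₂)) λ ()
  where
  a₂≡a₁ : a₂ ≡ a₁
  a₂≡a₁ = trans (T≡true⇒≡ T₂₁ (T≡false⇒≢starˡ T₂₂) b₁≢star)
                (sym (T≡true⇒≡ T₁₁ a₁≢star b₁≢star))

⋀-≡true : ∀ n (g : Fin n → Bool) → (∀ j → g j ≡ true) → ⋀ n g ≡ true
⋀-≡true zero    g g≡true = refl
⋀-≡true (suc n) g g≡true rewrite g≡true Fin.zero =
  ⋀-≡true n (λ j → g (Fin.suc j)) (λ j → g≡true (Fin.suc j))

⋀-≡true⁻ : ∀ n (g : Fin n → Bool) → ⋀ n g ≡ true → ∀ j → g j ≡ true
⋀-≡true⁻ (suc n) g ⋀≡true j with g Fin.zero in g₀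
⋀-≡true⁻ (suc n) g ⋀≡true Fin.zero    | true = g₀
⋀-≡true⁻ (suc n) g ⋀≡true (Fin.suc j) | true = ⋀-≡true⁻ n (λ j → g (Fin.suc j)) ⋀≡true j

⋀-≡false : ∀ n (g : Fin n → Bool) j → g j ≡ false → ⋀ n g ≡ false
⋀-≡false (suc n) g Fin.zero    g≡false rewrite g≡false = refl
⋀-≡false (suc n) g (Fin.suc j) g≡false with g Fin.zero
... | false = refl
... | true  = ⋀-≡false n (λ j → g (Fin.suc j)) j g≡false

⋀-≡false⁻ : ∀ n (g : Fin n → Bool) → ⋀ n g ≡ false → ∃ λ j → g j ≡ false
⋀-≡false⁻ (suc n) g ⋀≡false with g Fin.zero in g₀
... | false = Fin.zero , g₀
... | true  with j , gⱼ ← ⋀-≡false⁻ n (λ j → g (Fin.suc j)) ⋀≡false = Fin.suc j , gⱼ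

G-≡true : ∀ q {t x : Fin q} → t Fin.≤ x → G q t x ≡ true
G-≡true q {t} {x} t≤x = trans (isYes≗does (t Fin.≤? x)) (dec-true (t Fin.≤? x) t≤x)

G-≡false : ∀ q {t x : Fin q} → x Fin.< t → G q t x ≡ false
G-≡false q {t} {x} x<t = trans (isYes≗does (t Fin.≤? x)) (dec-false (t Fin.≤? x) (ℕ.<⇒≱ x<t))

module _ {A : Set} where

  indicator : Dec A → Fin 2
  indicator (yes _) = Fin.suc Fin.zero
  indicator (no _)  = Fin.zero

  indicator-yes : (a? : Dec A) → A → indicator a? ≡ Fin.suc Fin.zero
  indicator-yes (yes _) _ = refl
  indicator-yes (no ¬a) a = contradiction a ¬a

  indicator-yes⁻ : (a? : Dec A) → indicator a? ≡ Fin.suc Fin.zero → A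
  indicator-yes⁻ (yes a) _ = a

-- Pigeonhole with two holes per value: pair each index with whether its value
-- already occurred earlier; a collision of these pairs yields three equal values.
module _ {p n} (c : Fin p → Fin n) where

  private
    repeated? : ∀ k → Dec (∃ λ s → s Fin.< k × c s ≡ c k)
    repeated? k = Fin.any? (λ s → (s Fin.<? k) ×-dec (c s Fin.≟ c k))

    labelled : Fin p → Fin (n * 2)
    labelled k = combine (c k) (indicator (repeated? k))

  no-triple⇒≤*2 : (∀ {a b d} → a Fin.< b → b Fin.< d → c a ≡ c b → c b ≡ c d → ⊥) →
                  p ≤ n * 2
  no-triple⇒≤*2 no-triple with p ℕ.≤? n * 2
  ... | yes p≤2n = p≤2n
  ... | no  p≰2n with i , j , i<j , lᵢ≡lⱼ ← Fin.pigeonhole (ℕ.≰⇒> p≰2n) labelled =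
    let s , s<i , cₛ≡cᵢ = earlier in ⊥-elim (no-triple s<i i<j cₛ≡cᵢ cᵢ≡cⱼ)
    where
    components≡ : c i ≡ c j × indicator (repeated? i) ≡ indicator (repeated? j)
    components≡ = Fin.combine-injective (c i) _ (c j) _ lᵢ≡lⱼ

    cᵢ≡cⱼ : c i ≡ c j
    cᵢ≡cⱼ = proj₁ components≡

    earlier : ∃ λ s → s Fin.< i × c s ≡ c i
    earlier = indicator-yes⁻ (repeated? i)
      (trans (proj₂ components≡) (indicator-yes (repeated? j) (i , i<j , cᵢ≡cⱼ)))

module _ {p n} (u : Fin (suc p) → Fin n → Sym) (ϑ : Fin (suc p) → Fin n → Sym)
         (implements : ∀ t x → G (suc p) t x ≡ ⋀ n (λ j → T (u x j) (ϑ t j))) where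

  private
    Rejects : Fin p → Fin n → Set
    Rejects k j = T (u (inject₁ k) j) (ϑ (Fin.suc k) j) ≡ false

    rejecting : ∀ k → ∃ (Rejects k)
    rejecting k = ⋀-≡false⁻ n _ (trans (sym (implements (Fin.suc k) (inject₁ k)))
                                       (G-≡false (suc p) (Fin.≤̄⇒inject₁< (Fin.≤-refl {x = k}))))

    accepts : ∀ {k k′} → k Fin.< k′ → ∀ j → T (u (inject₁ k′) j) (ϑ (Fin.suc k) j) ≡ true
    accepts {k} {k′} k<k′ = ⋀-≡true⁻ n _ (trans (sym (implements (Fin.suc k) (inject₁ k′)))
      (G-≡true (suc p) (subst (suc (toℕ k) ℕ.≤_) (sym (Fin.toℕ-inject₁ k′)) k<k′)))

    cell : Fin p → Fin n
    cell k = proj₁ (rejecting k)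

    cell-no-triple : ∀ {a b d} → a Fin.< b → b Fin.< d → cell a ≡ cell b → cell b ≡ cell d → ⊥
    cell-no-triple {a} {b} {d} a<b b<d a∼b b∼d =
      T-rectangle (proj₂ (rejecting b)) (accepts a<b j) (accepts (ℕ.<-trans a<b b<d) j) (accepts b<d j)
        (T≡false⇒≢starʳ (subst (Rejects a) a∼b (proj₂ (rejecting a))))
        (T≡false⇒≢starˡ (subst (Rejects d) (sym b∼d) (proj₂ (rejecting d))))
      where
      j : Fin n
      j = cell b

  thresholds≤2*cells : p ≤ n * 2
  thresholds≤2*cells = no-triple⇒≤*2 cell cell-no-triple

-- Cell j is responsible for the thresholds 2j+1 and 2j+2: it stores b1 resp. •
-- for them and * for every other threshold, while input x is encoded as b0 if
-- x ≤ 2j, b1 if x = 2j+1 and * if x ≥ 2j+2.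
input : ℕ → ℕ → Sym
input zero                _       = b0
input (suc zero)          zero    = b1
input (suc zero)          (suc _) = b0
input (suc (suc x))       zero    = star
input (suc (suc x))       (suc j) = input x j

threshold : ℕ → ℕ → Sym
threshold zero                _       = star
threshold (suc zero)          zero    = b1
threshold (suc zero)          (suc _) = star
threshold (suc (suc t))       (suc j) = threshold t j
threshold (suc (suc zero))    zero    = bullet
threshold (suc (suc (suc _))) zero    = star

input-InB-sc* : ∀ x j → InB sc* (input x j)
input-InB-sc* zero                _       = tt
input-InB-sc* (suc zero)          zero    = tt
input-InB-sc* (suc zero)          (suc _) = tt
input-InB-sc* (suc (suc x))       zero    = tt
input-InB-sc* (suc (suc x))       (suc j) = input-InB-sc* x j

cell-accepts : ∀ {t x} → t ℕ.≤ x → ∀ j → T (input x j) (threshold t j) ≡ true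
cell-accepts {zero}                {x}             _                 j       = T-starʳ (input x j)
cell-accepts {suc zero}            {suc zero}      _                 zero    = refl
cell-accepts {suc zero}            {suc (suc _)}   _                 zero    = refl
cell-accepts {suc zero}            {x}             _                 (suc j) = T-starʳ (input x (suc j))
cell-accepts {suc (suc zero)}      {suc zero}      (s≤s ())          zero
cell-accepts {suc (suc zero)}      {suc (suc _)}   _                 zero    = refl
cell-accepts {suc (suc (suc _))}   {x}             _                 zero    = T-starʳ (input x zero)
cell-accepts {suc (suc t)}         {suc (suc x)}   (s≤s (s≤s t≤x))   (suc j) = cell-accepts t≤x j

cell-rejects : ∀ {s x} → x ℕ.≤ s → T (input x ⌊ s /2⌋) (threshold (suc s) ⌊ s /2⌋) ≡ false
cell-rejects {zero}          {zero}        _               = refl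
cell-rejects {suc zero}      {zero}        _               = refl
cell-rejects {suc zero}      {suc zero}    _               = refl
cell-rejects {suc zero}      {suc (suc _)} (s≤s ())
cell-rejects {suc (suc s)}   {zero}        _               = cell-rejects {s} z≤n
cell-rejects {suc (suc s)}   {suc zero}    _               = cell-rejects {s} z≤n
cell-rejects {suc (suc s)}   {suc (suc x)} (s≤s (s≤s x≤s)) = cell-rejects x≤s

m<n*2⇒⌊m/2⌋<n : ∀ {m n} → m ℕ.< n * 2 → ⌊ m /2⌋ ℕ.< n
m<n*2⇒⌊m/2⌋<n {zero}        {suc n} _                = z<s
m<n*2⇒⌊m/2⌋<n {suc zero}    {suc n} _                = z<s
m<n*2⇒⌊m/2⌋<n {suc (suc m)} {suc n} (s≤s (s≤s m<2n)) = s<s (m<n*2⇒⌊m/2⌋<n m<2n)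

some-cell-rejects : ∀ {n t x} → x ℕ.< t → t ℕ.≤ n * 2 →
                    ∃ λ (j : Fin n) → T (input x (toℕ j)) (threshold t (toℕ j)) ≡ false
some-cell-rejects {n} {suc s} {x} (s≤s x≤s) s<2n =
  fromℕ< j<n , subst (λ j → T (input x j) (threshold (suc s) j) ≡ false)
                     (sym (Fin.toℕ-fromℕ< j<n)) (cell-rejects x≤s)
  where
  j<n : ⌊ s /2⌋ ℕ.< n
  j<n = m<n*2⇒⌊m/2⌋<n s<2n

2*n+1≡1+n*2 : ∀ n → 2 * n + 1 ≡ suc (n * 2)
2*n+1≡1+n*2 n = trans (ℕ.+-comm (2 * n) 1) (cong suc (ℕ.*-comm 2 n))

InB-sc*⇒InB : ∀ {α s} → α ≡ sc* ⊎ α ≡ sc• → InB sc* s → InB α s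
InB-sc*⇒InB (inj₁ refl) s∈𝔹* = s∈𝔹*
InB-sc*⇒InB (inj₂ refl) _    = tt

≤1+n*2⇒implementable : ∀ q n α → α ≡ sc* ⊎ α ≡ sc• → q ≤ suc (n * 2) →
                       Implementable α sc• q n (G q)
≤1+n*2⇒implementable q n α α∈*• q≤1+2n =
  u , ϑ , (λ x j → InB-sc*⇒InB α∈*• (input-InB-sc* (toℕ x) (toℕ j))) , (λ _ _ → tt) , implements
  where
  u : Fin q → Fin n → Sym
  u x j = input (toℕ x) (toℕ j)

  ϑ : Fin q → Fin n → Sym
  ϑ t j = threshold (toℕ t) (toℕ j)

  implements : ∀ t x → G q t x ≡ ⋀ n (λ j → T (u x j) (ϑ t j))
  implements t x with ℕ.≤-<-connex (toℕ t) (toℕ x)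
  ... | inj₁ t≤x = trans (G-≡true q t≤x) (sym (⋀-≡true n _ (λ j → cell-accepts t≤x (toℕ j))))
  ... | inj₂ x<t = trans (G-≡false q x<t) (sym (⋀-≡false n _ j rejects))
    where
    t≤2n : toℕ t ≤ n * 2
    t≤2n = ℕ.s≤s⁻¹ (ℕ.≤-trans (Fin.toℕ<n t) q≤1+2n)
    j : Fin n
    j = proj₁ (some-cell-rejects x<t t≤2n)
    rejects : T (u x j) (ϑ t j) ≡ false
    rejects = proj₂ (some-cell-rejects x<t t≤2n)

implementable⇒≤1+n*2 : ∀ {α β} q n → Implementable α β q n (G q) → q ≤ suc (n * 2)
implementable⇒≤1+n*2 zero    n _                            = z≤n
implementable⇒≤1+n*2 (suc p) n (u , ϑ , _ , _ , implements) = s≤s (thresholds≤2*cells u ϑ implements)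

proposition10 : (q n : ℕ) → 2 ≤ q → 1 ≤ n → (α : Scen) → (α ≡ sc* ⊎ α ≡ sc•) →
    (Implementable α sc• q n (G q) ⇔ (q ≤ 2 * n + 1))
proposition10 q n _ _ α α∈*• rewrite 2*n+1≡1+n*2 n =
  mk⇔ (implementable⇒≤1+n*2 {β = sc•} q n) (≤1+n*2⇒implementable q n α α∈*•)
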